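{- Let $H$ be a bipartite matching covered graph and $u$ a vertex of $H$ of degree at least three. If $f_1$ and $f_2$ are two edges incident with $u$ that lie in a common 4-cycle of $H$, then at least one of $f_1$ and $f_2$ is removable in $H$.
   Context: Graphs are finite and may have multiple edges but no loops. A connected graph with at least two vertices is matching covered if every edge lies in some perfect matching. An edge $e$ of a matching covered graph $H$ is removable if $H-e$ is matching covered. -}

module Defs where

open import Data.Nat using (ℕ; zero; suc; _≤_)
open import Data.Fin using (Fin; punchIn; _≟_)
open import Data.Fin.Subset using (Subset; _∈_)
open import Data.Product using (_×_; _,_; Σ; ∃; ∃-syntax; proj₁; proj₂)
open import Data.Sum using (_⊎_)
open import Data.Bool using (Bool)
open import Data.List using (List; length; filter)
open import Data.List using () renaming ([] to nil)
open import Data.Fin using () renaming (zero to fzero)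
open import Data.Fin.Base using ()
open import Data.List.Base using ()
open import Data.Empty using (⊥)
open import Relation.Nullary using (¬_; Dec; yes; no)
open import Relation.Nullary.Decidable using (_⊎-dec_)
open import Relation.Binary.PropositionalEquality using (_≡_; _≢_)
import Data.List.Base as L
import Data.Fin.Base as F

-- A finite multigraph without loops: vertices Fin n, edges Fin m,
-- each edge has two distinct ends (parallel edges allowed).
record Graph (n m : ℕ) : Set where
  field
    ends  : Fin m → Fin n × Fin n
    loopless : ∀ e → proj₁ (ends e) ≢ proj₂ (ends e)
open Graph public

module _ {n m : ℕ} (H : Graph n m) where

  Incident : Fin m → Fin n → Set
  Incident e v = (proj₁ (ends H e) ≡ v) ⊎ (proj₂ (ends H e) ≡ v)

  incident? : (v : Fin n) (e : Fin m) → Dec (Incident e v)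
  incident? v e = (proj₁ (ends H e) ≟ v) ⊎-dec (proj₂ (ends H e) ≟ v)

  Joins : Fin m → Fin n → Fin n → Set
  Joins e x y = (ends H e ≡ (x , y)) ⊎ (ends H e ≡ (y , x))

  degree : Fin n → ℕ
  degree v = length (filter (incident? v) (L.allFin m))

  data Walk : Fin n → Fin n → Set where
    here : ∀ {v} → Walk v v
    step : ∀ {x y z} (e : Fin m) → Joins e x y → Walk y z → Walk x z

  Connected : Set
  Connected = 2 ≤ n × (∀ x y → Walk x y)

  IsPerfectMatching : Subset m → Set
  IsPerfectMatching M =
    ∀ v → Σ (Fin m) λ e → e ∈ M × Incident e v ×
            (∀ e′ → e′ ∈ M → Incident e′ v → e′ ≡ e)

  MatchingCovered : Set
  MatchingCovered = Connected ×
    (∀ e → Σ (Subset m) λ M → IsPerfectMatching M × e ∈ M)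

  Bipartite : Set
  Bipartite = Σ (Fin n → Bool) λ c → ∀ e → c (proj₁ (ends H e)) ≢ c (proj₂ (ends H e))

  InCommon4Cycle : Fin m → Fin m → Set
  InCommon4Cycle f₁ f₂ =
    Σ (Fin n) λ v₀ → Σ (Fin n) λ v₁ → Σ (Fin n) λ v₂ → Σ (Fin n) λ v₃ →
    Σ (Fin m) λ e₀ → Σ (Fin m) λ e₁ → Σ (Fin m) λ e₂ → Σ (Fin m) λ e₃ →
      (v₀ ≢ v₁ × v₀ ≢ v₂ × v₀ ≢ v₃ × v₁ ≢ v₂ × v₁ ≢ v₃ × v₂ ≢ v₃) ×
      (Joins e₀ v₀ v₁ × Joins e₁ v₁ v₂ × Joins e₂ v₂ v₃ × Joins e₃ v₃ v₀) ×
      OnCycle e₀ e₁ e₂ e₃ f₁ × OnCycle e₀ e₁ e₂ e₃ f₂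
    where
      OnCycle : Fin m → Fin m → Fin m → Fin m → Fin m → Set
      OnCycle a b c d f = f ≡ a ⊎ f ≡ b ⊎ f ≡ c ⊎ f ≡ d

-- H - e : delete edge e (remaining edges renumbered via punchIn)
_-ₑ_ : ∀ {n k} → Graph n (suc k) → Fin (suc k) → Graph n k
ends (H -ₑ e) i = ends H (punchIn e i)
loopless (H -ₑ e) i = loopless H (punchIn e i)

Removable : ∀ {n m} → Graph n m → Fin m → Set
Removable {m = zero} H ()
Removable {m = suc k} H e = MatchingCovered (H -ₑ e)

module Submission where

-- Fix a perfect matching M containing a third edge f₃ at u, so that f₁, f₂ ∉ M, and call
-- a ↦ mate (other e a) an e-hop. In a matching covered graph every set of vertices closed under
-- all hops meets every edge of M. The 4-cycle gives a detour around each fᵢ, so fᵢ is removable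
-- unless some other edge g forces it (every perfect matching through g uses fᵢ). If g forces f, let
-- x be the end of g in the colour class of u and take the vertices reachable by hops avoiding f from
-- the M-mate of the other end of g. This region misses x, since switching M along an alternating
-- path to x would give a perfect matching through g avoiding f; being closed under all hops except
-- along f, it must then contain u but not the f-hop of u. If both f₁ and f₂ were forced, the union
-- of their regions would be closed under all hops yet miss the corner of the 4-cycle opposite u
-- together with its mate.

open import Data.Bool using (Bool; true; false) renaming (_≟_ to _≟ᵇ_)
open import Data.Bool.Properties using (¬-not)
open import Data.Empty using (⊥; ⊥-elim)
open import Data.Fin using (Fin; _≟_; toℕ; punchIn; punchOut)
open import Data.Fin.Properties
  using (pigeonhole; any?; all?; ¬∀⟶∃¬; punchIn-punchOut; punchIn-injective; punchInᵢ≢i)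
open import Data.Fin.Subset using (Subset; _∈_; _∉_)
open import Data.Fin.Subset.Properties using (_∈?_; anySubset?)
open import Data.List using (List; []; _∷_; length; filter; allFin)
open import Data.List.Relation.Unary.All as All using (All; []; _∷_)
open import Data.List.Relation.Unary.All.Properties using (all-filter)
open import Data.List.Relation.Unary.AllPairs using ([]; _∷_)
open import Data.List.Relation.Unary.Unique.Propositional using (Unique)
open import Data.List.Relation.Unary.Unique.Propositional.Properties using (allFin⁺; filter⁺)
open import Data.Nat using (ℕ; zero; suc; z≤n; s≤s; _<_; _≤_)
open import Data.Nat.Properties using (n<1+n; ≤-trans)
open import Data.Product using (Σ; ∃; _×_; _,_; proj₁; proj₂)
open import Data.Sum using (_⊎_; inj₁; inj₂; [_,_]; swap)
open import Data.Vec using (lookup; tabulate; _[_]≔_)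
open import Data.Vec.Properties
  using ([]=⇒lookup; lookup⇒[]=; lookup∘updateAt; lookup∘updateAt′; []≔-updates; []≔-minimal; lookup∘tabulate)
open import Function using (_∘_)
open import Function.Definitions using (Injective)
open import Relation.Nullary using (¬_; Dec; yes; no)
open import Relation.Nullary.Decidable using (¬¬-excluded-middle; ¬?; _×-dec_; _→-dec_)
open import Relation.Binary.PropositionalEquality
  using (_≡_; _≢_; refl; sym; trans; cong; cong₂; subst; module ≡-Reasoning)

open import Defs

≢-≢⇒≡ : ∀ {x y z : Bool} → x ≢ y → y ≢ z → x ≡ z
≢-≢⇒≡ x≢y y≢z = trans (¬-not x≢y) (sym (¬-not (y≢z ∘ sym)))

iterate : ∀ {A : Set} → (A → A) → ℕ → A → A
iterate f zero    x = x
iterate f (suc k) x = f (iterate f k x)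

iterate-returns : ∀ {n} (f : Fin n → Fin n) → Injective _≡_ _≡_ f →
  ∀ x → ∃ λ k → iterate f (suc k) x ≡ x
iterate-returns {n} f f-inj x
  with i , j , i<j , eq ← pigeonhole (n<1+n n) (λ (i : Fin (suc n)) → iterate f (toℕ i) x)
  = back (toℕ i) (toℕ j) i<j eq
  where
  back : ∀ i j → i < j → iterate f i x ≡ iterate f j x → ∃ λ k → iterate f (suc k) x ≡ x
  back zero    (suc k) _         eq = k , sym eq
  back (suc i) (suc j) (s≤s i<j) eq = back i j i<j (f-inj eq)

preimage-closed : ∀ {n} (f : Fin n → Fin n) → Injective _≡_ _≡_ f →
  (R : Fin n → Set) → (∀ x → R x → R (f x)) → ∀ x → R (f x) → R x
preimage-closed f f-inj R closed x Rfx
  with k , eq ← iterate-returns f f-inj (f x)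
  = subst R (f-inj eq) (iterated k (f x) Rfx)
  where
  iterated : ∀ k x → R x → R (iterate f k x)
  iterated zero    x Rx = Rx
  iterated (suc k) x Rx = closed _ (iterated k x Rx)

∈-update⁻ : ∀ {m} (N : Subset m) i b {j} → j ∈ N [ i ]≔ b → (j ≡ i × b ≡ true) ⊎ (j ≢ i × j ∈ N)
∈-update⁻ N i b {j} j∈ with j ≟ i
... | yes refl = inj₁ (refl , trans (sym (lookup∘updateAt i N)) ([]=⇒lookup j∈))
... | no  j≢i  = inj₂ (j≢i , lookup⇒[]= j N (trans (sym (lookup∘updateAt′ j i j≢i N)) ([]=⇒lookup j∈)))

∈-insert : ∀ {m} (N : Subset m) i {j} → j ∈ N → j ∈ N [ i ]≔ true
∈-insert N i {j} j∈N with j ≟ i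
... | yes refl = []≔-updates N i
... | no  j≢i  = []≔-minimal N j i j≢i j∈N

∈-insert⁻ : ∀ {m} (N : Subset m) i {j} → j ∈ N [ i ]≔ true → j ≡ i ⊎ j ∈ N
∈-insert⁻ N i j∈ with ∈-update⁻ N i true j∈
... | inj₁ (j≡i , _) = inj₁ j≡i
... | inj₂ (_ , j∈N) = inj₂ j∈N

∈-delete⁻ : ∀ {m} (N : Subset m) i {j} → j ∈ N [ i ]≔ false → j ≢ i × j ∈ N
∈-delete⁻ N i j∈ with ∈-update⁻ N i false j∈
... | inj₂ j≢i×j∈N = j≢i×j∈N

∉-insert : ∀ {m} (N : Subset m) {i j} → j ∉ N → j ≢ i → j ∉ N [ i ]≔ true
∉-insert N j∉N j≢i j∈ with ∈-insert⁻ N _ j∈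
... | inj₁ j≡i = j≢i j≡i
... | inj₂ j∈N = j∉N j∈N

∉-delete : ∀ {m} (N : Subset m) {i j} → j ∉ N → j ∉ N [ i ]≔ false
∉-delete N j∉N = j∉N ∘ proj₂ ∘ ∈-delete⁻ N _

module Ends {n m : ℕ} (H : Graph n m) where

  -- for z not an end of e the value is junk
  other : Fin m → Fin n → Fin n
  other e z with proj₁ (ends H e) ≟ z
  ... | yes _ = proj₂ (ends H e)
  ... | no  _ = proj₁ (ends H e)

  other-cases : ∀ e {z} → Incident H e z →
    (proj₁ (ends H e) ≡ z × other e z ≡ proj₂ (ends H e)) ⊎
    (proj₂ (ends H e) ≡ z × other e z ≡ proj₁ (ends H e))
  other-cases e {z} e∋z with proj₁ (ends H e) ≟ z | e∋z
  ... | yes p | _      = inj₁ (p , refl)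
  ... | no ¬p | inj₁ p = ⊥-elim (¬p p)
  ... | no _  | inj₂ q = inj₂ (q , refl)

  incident-other : ∀ e z → Incident H e (other e z)
  incident-other e z with proj₁ (ends H e) ≟ z
  ... | yes _ = inj₂ refl
  ... | no  _ = inj₁ refl

  other-≢ : ∀ e {z} → Incident H e z → other e z ≢ z
  other-≢ e e∋z eq with other-cases e e∋z
  ... | inj₁ (p , o) = loopless H e (trans p (trans (sym eq) o))
  ... | inj₂ (q , o) = loopless H e (trans (sym o) (trans eq (sym q)))

  incident-ends : ∀ e {z z′} → Incident H e z → Incident H e z′ → z′ ≡ z ⊎ z′ ≡ other e z
  incident-ends e e∋z e∋z′ with other-cases e e∋z | e∋z′
  ... | inj₁ (p , _) | inj₁ p′ = inj₁ (trans (sym p′) p)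
  ... | inj₁ (_ , o) | inj₂ q′ = inj₂ (trans (sym q′) (sym o))
  ... | inj₂ (_ , o) | inj₁ p′ = inj₂ (trans (sym p′) (sym o))
  ... | inj₂ (q , _) | inj₂ q′ = inj₁ (trans (sym q′) q)

  other-involutive : ∀ e {z} → Incident H e z → other e (other e z) ≡ z
  other-involutive e {z} e∋z with incident-ends e (incident-other e z) e∋z
  ... | inj₁ z≡o  = ⊥-elim (other-≢ e e∋z (sym z≡o))
  ... | inj₂ z≡oo = sym z≡oo

  not-an-end : ∀ e {a z} → Incident H e a → z ≢ a → z ≢ other e a → ¬ Incident H e z
  not-an-end e e∋a z≢a z≢o e∋z with incident-ends e e∋a e∋z
  ... | inj₁ z≡a = z≢a z≡a
  ... | inj₂ z≡o = z≢o z≡o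

  joins-sym : ∀ {e x y} → Joins H e x y → Joins H e y x
  joins-sym (inj₁ p) = inj₂ p
  joins-sym (inj₂ p) = inj₁ p

  joins⇒other : ∀ {e x y} → Joins H e x y → Incident H e x × other e x ≡ y
  joins⇒other {e} {x} {y} (inj₁ ends≡) with e∋x ← inj₁ (cong proj₁ ends≡) with other-cases e e∋x
  ... | inj₁ (_ , o) = e∋x , trans o (cong proj₂ ends≡)
  ... | inj₂ (q , _) = ⊥-elim (loopless H e (trans (cong proj₁ ends≡) (sym q)))
  joins⇒other {e} {x} {y} (inj₂ ends≡) with e∋x ← inj₂ (cong proj₂ ends≡) with other-cases e e∋x
  ... | inj₁ (p , _) = ⊥-elim (loopless H e (trans p (sym (cong proj₂ ends≡))))
  ... | inj₂ (_ , o) = e∋x , trans o (cong proj₁ ends≡)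

  other⇒joins : ∀ e {x y} → Incident H e x → other e x ≡ y → Joins H e x y
  other⇒joins e e∋x o with other-cases e e∋x
  ... | inj₁ (p , o′) = inj₁ (cong₂ _,_ p (trans (sym o′) o))
  ... | inj₂ (q , o′) = inj₂ (cong₂ _,_ (trans (sym o′) o) q)

  joins-ends : ∀ {e x y z} → Joins H e x y → Incident H e z → z ≡ x ⊎ z ≡ y
  joins-ends {e} {x} {y} {z} e-xy e∋z with e∋x , o ← joins⇒other e-xy
    = subst (λ v → z ≡ x ⊎ z ≡ v) o (incident-ends e e∋x e∋z)

  module Colouring (c : Fin n → Bool) (proper : ∀ e → c (proj₁ (ends H e)) ≢ c (proj₂ (ends H e))) where

    other-colour : ∀ e {z} → Incident H e z → c (other e z) ≢ c z
    other-colour e e∋z eq with other-cases e e∋z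
    ... | inj₁ (p , o) = proper e (trans (cong c p) (trans (sym eq) (cong c o)))
    ... | inj₂ (q , o) = proper e (trans (sym (cong c o)) (trans eq (sym (cong c q))))

    same-colour-end : ∀ e {u a} → Incident H e u → Incident H e a → c a ≡ c u → a ≡ u
    same-colour-end e e∋u e∋a ca≡cu with incident-ends e e∋u e∋a
    ... | inj₁ a≡u = a≡u
    ... | inj₂ a≡o = ⊥-elim (other-colour e e∋u (trans (cong c (sym a≡o)) ca≡cu))

    end-of-colour : ∀ e β → Σ (Fin n) λ x → Σ (Fin n) λ y → Joins H e x y × c x ≡ β
    end-of-colour e β with c (proj₁ (ends H e)) ≟ᵇ β
    ... | yes p = _ , _ , inj₁ refl , p
    ... | no ¬p = _ , _ , inj₂ refl , ≢-≢⇒≡ (proper e ∘ sym) ¬p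

module Covering {n m : ℕ} (H : Graph n m) where

  CoveredOnceBy : Subset m → Fin n → Fin m → Set
  CoveredOnceBy N z e = e ∈ N × Incident H e z × (∀ e′ → e′ ∈ N → Incident H e′ z → e′ ≡ e)

  CoveredOnce : Subset m → Fin n → Set
  CoveredOnce N z = Σ (Fin m) (CoveredOnceBy N z)

  Uncovered : Subset m → Fin n → Set
  Uncovered N z = ∀ e → e ∈ N → ¬ Incident H e z

  coveredOnce⇒by : ∀ {N z e} → CoveredOnce N z → e ∈ N → Incident H e z → CoveredOnceBy N z e
  coveredOnce⇒by (ε , _ , _ , unique) e∈N e∋z =
    e∈N , e∋z , λ e′ e′∈N e′∋z → trans (unique e′ e′∈N e′∋z) (sym (unique _ e∈N e∋z))

  coveredOnceBy-delete : ∀ {N z ε} d → ε ≢ d → CoveredOnceBy N z ε → CoveredOnceBy (N [ d ]≔ false) z ε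
  coveredOnceBy-delete {N} d ε≢d (ε∈N , ε∋z , unique) =
    []≔-minimal N _ d ε≢d ε∈N , ε∋z , λ e′ e′∈ → unique e′ (proj₂ (∈-delete⁻ N d e′∈))

  coveredOnceBy-delete-self : ∀ {N z d} → CoveredOnceBy N z d → Uncovered (N [ d ]≔ false) z
  coveredOnceBy-delete-self {N} {d = d} (_ , _ , unique) e e∈ e∋z with e≢d , e∈N ← ∈-delete⁻ N d e∈
    = e≢d (unique e e∈N e∋z)

  uncovered-delete : ∀ {N z} d → Uncovered N z → Uncovered (N [ d ]≔ false) z
  uncovered-delete {N} d z-free e e∈ = z-free e (proj₂ (∈-delete⁻ N d e∈))

  coveredOnceBy-insert : ∀ {N z ε} e → ¬ Incident H e z → CoveredOnceBy N z ε →
    CoveredOnceBy (N [ e ]≔ true) z ε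
  coveredOnceBy-insert {N} {z} {ε} e e∌z (ε∈N , ε∋z , unique) = ∈-insert N e ε∈N , ε∋z , unique′
    where
    unique′ : ∀ e′ → e′ ∈ N [ e ]≔ true → Incident H e′ z → e′ ≡ ε
    unique′ e′ e′∈ e′∋z with ∈-insert⁻ N e e′∈
    ... | inj₁ refl = ⊥-elim (e∌z e′∋z)
    ... | inj₂ e′∈N = unique e′ e′∈N e′∋z

  uncovered-insert : ∀ {N z} e → Incident H e z → Uncovered N z → CoveredOnceBy (N [ e ]≔ true) z e
  uncovered-insert {N} {z} e e∋z z-free = []≔-updates N e , e∋z , unique
    where
    unique : ∀ e′ → e′ ∈ N [ e ]≔ true → Incident H e′ z → e′ ≡ e
    unique e′ e′∈ e′∋z with ∈-insert⁻ N e e′∈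
    ... | inj₁ e′≡e = e′≡e
    ... | inj₂ e′∈N = ⊥-elim (z-free e′ e′∈N e′∋z)

  uncovered-insert-far : ∀ {N z} e → ¬ Incident H e z → Uncovered N z → Uncovered (N [ e ]≔ true) z
  uncovered-insert-far {N} e e∌z z-free e′ e′∈ e′∋z with ∈-insert⁻ N e e′∈
  ... | inj₁ refl = e∌z e′∋z
  ... | inj₂ e′∈N = z-free e′ e′∈N e′∋z

module PerfectMatching {n m : ℕ} (H : Graph n m) {M : Subset m} (pm : IsPerfectMatching H M) where
  open Ends H
  open Covering H

  edgeAt : Fin n → Fin m
  edgeAt z = proj₁ (pm z)

  edgeAt-covers : ∀ z → CoveredOnceBy M z (edgeAt z)
  edgeAt-covers z = proj₂ (pm z)

  edgeAt-incident : ∀ z → Incident H (edgeAt z) z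
  edgeAt-incident z = proj₁ (proj₂ (edgeAt-covers z))

  edgeAt-unique : ∀ z e → e ∈ M → Incident H e z → e ≡ edgeAt z
  edgeAt-unique z = proj₂ (proj₂ (edgeAt-covers z))

  mate : Fin n → Fin n
  mate z = other (edgeAt z) z

  mate-≢ : ∀ z → mate z ≢ z
  mate-≢ z = other-≢ (edgeAt z) (edgeAt-incident z)

  edgeAt-mate : ∀ z → edgeAt (mate z) ≡ edgeAt z
  edgeAt-mate z = sym (edgeAt-unique (mate z) (edgeAt z) (proj₁ (edgeAt-covers z)) (incident-other (edgeAt z) z))

  mate-involutive : ∀ z → mate (mate z) ≡ z
  mate-involutive z = begin
    other (edgeAt (mate z)) (mate z)  ≡⟨ cong (λ e → other e (mate z)) (edgeAt-mate z) ⟩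
    other (edgeAt z) (mate z)         ≡⟨ other-involutive (edgeAt z) (edgeAt-incident z) ⟩
    z                                 ∎
    where open ≡-Reasoning

  mate-injective : Injective _≡_ _≡_ mate
  mate-injective {x} {y} eq = trans (sym (mate-involutive x)) (trans (cong mate eq) (mate-involutive y))

  edgeAt-≢ : ∀ {z a} → z ≢ a → z ≢ mate a → edgeAt z ≢ edgeAt a
  edgeAt-≢ {z} {a} z≢a z≢mate eq
    with incident-ends (edgeAt a) (edgeAt-incident a) (subst (λ e → Incident H e z) eq (edgeAt-incident z))
  ... | inj₁ z≡a    = z≢a z≡a
  ... | inj₂ z≡mate = z≢mate z≡mate

  -- the M-alternating step a —e— other e a —M— hop e a
  hop : Fin m → Fin n → Fin n
  hop e a = mate (other e a)

  HopClosed : (Fin n → Set) → Set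
  HopClosed R = ∀ e a → Incident H e a → R a → R (hop e a)

  HopClosedAvoiding : Fin m → (Fin n → Set) → Set
  HopClosedAvoiding f R = ∀ e a → e ≢ f → Incident H e a → R a → R (hop e a)

walk-preserves : ∀ {n m} {H : Graph n m} (P : Fin n → Set) →
  (∀ {e z z′} → Joins H e z z′ → P z → P z′) → ∀ {x y} → Walk H x y → P x → P y
walk-preserves P preserves here           Px = Px
walk-preserves P preserves (step e e-xy w) Px = walk-preserves P preserves w (preserves e-xy Px)

module BipartiteMatching {n m : ℕ} (H : Graph n m)
  (c : Fin n → Bool) (proper : ∀ e → c (proj₁ (ends H e)) ≢ c (proj₂ (ends H e)))
  {M : Subset m} (pm : IsPerfectMatching H M) where
  open Ends H
  open Colouring c proper
  open PerfectMatching H pm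

  mate-colour : ∀ z → c (mate z) ≢ c z
  mate-colour z = other-colour (edgeAt z) (edgeAt-incident z)

  same-colour⇒≢mate : ∀ {z a} → c z ≡ c a → z ≢ mate a
  same-colour⇒≢mate cz≡ca refl = mate-colour _ cz≡ca

  hop-colour : ∀ e {a} → Incident H e a → c (hop e a) ≡ c a
  hop-colour e {a} e∋a = ≢-≢⇒≡ (mate-colour (other e a)) (other-colour e e∋a)

module MatchingCovered {n m : ℕ} (H : Graph n m)
  (walk : ∀ x y → Walk H x y) (covered : ∀ e → Σ (Subset m) λ N → IsPerfectMatching H N × e ∈ N)
  {M : Subset m} (pm : IsPerfectMatching H M) where
  open Ends H
  open PerfectMatching H pm

  -- To cross an edge e = zz′ from R (mate z), take a perfect matching N ∋ e: R is closed under the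
  -- permutation mate ∘ mateₙ, which sends z′ to mate z, hence also under its inverse.
  hopClosed-meets : ∀ {R} → HopClosed R → ∀ {r} → R r → ∀ t → R t ⊎ R (mate t)
  hopClosed-meets {R} closed {r} Rr t = walk-preserves P across (walk r t) (inj₁ Rr)
    where
    P : Fin n → Set
    P z = R z ⊎ R (mate z)
    across : ∀ {e z z′} → Joins H e z z′ → P z → P z′
    across {e} {z} {z′} e-zz′ (inj₁ Rz) with e∋z , oz ← joins⇒other e-zz′
      = inj₂ (subst (R ∘ mate) oz (closed e z e∋z Rz))
    across {e} {z} {z′} e-zz′ (inj₂ Rmz) with N , pmN , e∈N ← covered e
      = inj₁ (preimage-closed ψ ψ-injective R (λ s → closed _ s (N.edgeAt-incident s)) z′
                (subst (R ∘ mate) (sym N-mate-z′) Rmz))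
      where
      module N = PerfectMatching H pmN
      ψ : Fin n → Fin n
      ψ s = mate (N.mate s)
      ψ-injective : Injective _≡_ _≡_ ψ
      ψ-injective = N.mate-injective ∘ mate-injective
      N-mate-z′ : N.mate z′ ≡ z
      N-mate-z′ with e∋z′ , oz′ ← joins⇒other (joins-sym e-zz′) =
        trans (cong (λ d → other d z′) (sym (N.edgeAt-unique z′ e e∈N e∋z′))) oz′

Forces : ∀ {n m} → Graph n m → Fin m → Fin m → Set
Forces H g f = ∀ N → IsPerfectMatching H N → g ∈ N → f ∈ N

MatchingThroughAvoiding : ∀ {n m} → Graph n m → Fin m → Fin m → Set
MatchingThroughAvoiding {m = m} H g f = Σ (Subset m) λ N → IsPerfectMatching H N × g ∈ N × f ∉ N

Avoidable : ∀ {n m} → Graph n m → Fin m → Set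
Avoidable H f = ∀ g → g ≢ f → MatchingThroughAvoiding H g f

module Switching {n m : ℕ} (H : Graph n m)
  (c : Fin n → Bool) (proper : ∀ e → c (proj₁ (ends H e)) ≢ c (proj₂ (ends H e)))
  {M : Subset m} (pm : IsPerfectMatching H M)
  {f g : Fin m} (f∉M : f ∉ M) (g≢f : g ≢ f) {x b : Fin n} (g-xb : Joins H g x b) where
  open Ends H
  open Colouring c proper
  open Covering H
  open PerfectMatching H pm
  open BipartiteMatching H c proper pm

  y : Fin n
  y = mate b

  data Reach : ℕ → Fin n → Set where
    start  : ∀ {k} → Reach k y
    hop-by : ∀ {k e a} → e ≢ f → Incident H e a → Reach k a → Reach (suc k) (hop e a)

  reach-weaken : ∀ {k a} → Reach k a → Reach (suc k) a
  reach-weaken start              = start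
  reach-weaken (hop-by e≢f e∋a r) = hop-by e≢f e∋a (reach-weaken r)

  reach-colour : ∀ {k a} → Reach k a → c a ≡ c y
  reach-colour start              = refl
  reach-colour (hop-by {e = e} _ e∋a r) = trans (hop-colour e e∋a) (reach-colour r)

  y-colour : c y ≡ c x
  y-colour with g∋x , gx≡b ← joins⇒other g-xb
    = ≢-≢⇒≡ (mate-colour b) (subst (λ v → c v ≢ c x) gx≡b (other-colour g g∋x))

  b≢reached : ∀ {k a} → Reach k a → b ≢ a
  b≢reached r refl = mate-colour b (sym (reach-colour r))

  -- N is M switched along an M-alternating path from y to a that avoids f;
  -- it is a perfect matching of H − b − a.
  record Switched (k : ℕ) (a : Fin n) (N : Subset m) : Set where
    field
      f∉N         : f ∉ N
      b-uncovered : Uncovered N b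
      a-uncovered : Uncovered N a
      covered     : ∀ z → z ≢ b → z ≢ a → CoveredOnce N z
      untouched   : ∀ z → c z ≡ c y → ¬ Reach k z → edgeAt z ∈ N

  open Switched

  switched-start : ∀ k → Switched k y (M [ edgeAt y ]≔ false)
  f∉N         (switched-start k) = ∉-delete M f∉M
  b-uncovered (switched-start k) =
    coveredOnceBy-delete-self (subst (CoveredOnceBy M b) (sym (edgeAt-mate b)) (edgeAt-covers b))
  a-uncovered (switched-start k) = coveredOnceBy-delete-self (edgeAt-covers y)
  covered     (switched-start k) z z≢b z≢y =
    _ , coveredOnceBy-delete (edgeAt y) (edgeAt-≢ z≢y (subst (z ≢_) (sym (mate-involutive b)) z≢b))
          (edgeAt-covers z)
  untouched   (switched-start k) z cz≡cy ¬r =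
    []≔-minimal M _ (edgeAt y) (edgeAt-≢ z≢y (same-colour⇒≢mate cz≡cy)) (proj₁ (edgeAt-covers z))
    where
    z≢y : z ≢ y
    z≢y refl = ¬r start

  switched-weaken : ∀ {k a N} → Switched k a N → Switched (suc k) a N
  f∉N         (switched-weaken S) = f∉N S
  b-uncovered (switched-weaken S) = b-uncovered S
  a-uncovered (switched-weaken S) = a-uncovered S
  covered     (switched-weaken S) = covered S
  untouched   (switched-weaken S) z cz≡cy ¬r = untouched S z cz≡cy (¬r ∘ reach-weaken)

  module Extend {k e a N} (e≢f : e ≢ f) (e∋a : Incident H e a) (r : Reach k a)
    (new : ¬ Reach k (hop e a)) (S : Switched k a N) where

    z₀ a′ : Fin n
    z₀ = other e a
    a′ = hop e a

    d : Fin m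
    d = edgeAt a′

    ca′≡cy : c a′ ≡ c y
    ca′≡cy = trans (hop-colour e e∋a) (reach-colour r)

    a≢a′ : a ≢ a′
    a≢a′ a≡a′ = new (subst (Reach k) a≡a′ r)

    z₀≢b : z₀ ≢ b
    z₀≢b refl = new start

    mate-a′ : mate a′ ≡ z₀
    mate-a′ = mate-involutive z₀

    d-covers : ∀ {z} → z ≡ a′ ⊎ z ≡ z₀ → z ≢ b → z ≢ a → CoveredOnceBy N z d
    d-covers {z} z∈d z≢b z≢a =
      coveredOnce⇒by (covered S z z≢b z≢a) (untouched S a′ ca′≡cy new) (d∋ z∈d)
      where
      d∋ : z ≡ a′ ⊎ z ≡ z₀ → Incident H d z
      d∋ (inj₁ refl) = edgeAt-incident a′
      d∋ (inj₂ refl) = subst (Incident H d) mate-a′ (incident-other d a′)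

    N₁ N′ : Subset m
    N₁ = N [ d ]≔ false
    N′ = N₁ [ e ]≔ true

    covered₁ : ∀ z → z ≢ b → z ≢ a → z ≢ a′ → z ≢ z₀ → CoveredOnce N₁ z
    covered₁ z z≢b z≢a z≢a′ z≢z₀ with ε , cov ← covered S z z≢b z≢a = ε , coveredOnceBy-delete d ε≢d cov
      where
      ε≢d : ε ≢ d
      ε≢d refl with incident-ends d (edgeAt-incident a′) (proj₁ (proj₂ cov))
      ... | inj₁ z≡a′ = z≢a′ z≡a′
      ... | inj₂ z≡z₀ = z≢z₀ (trans z≡z₀ mate-a′)

    extended : Switched (suc k) a′ N′
    f∉N         extended = ∉-insert N₁ (∉-delete N (f∉N S)) (e≢f ∘ sym)
    b-uncovered extended =
      uncovered-insert-far e (not-an-end e e∋a (b≢reached r) (z₀≢b ∘ sym)) (uncovered-delete d (b-uncovered S))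
    a-uncovered extended =
      uncovered-insert-far e (not-an-end e e∋a (a≢a′ ∘ sym) (mate-≢ z₀))
        (coveredOnceBy-delete-self (d-covers (inj₁ refl) (b≢reached (hop-by e≢f e∋a r) ∘ sym) (a≢a′ ∘ sym)))
    covered     extended z z≢b z≢a′ with z ≟ a | z ≟ z₀
    ... | yes refl | _       = e , uncovered-insert e e∋a (uncovered-delete d (a-uncovered S))
    ... | no z≢a   | yes refl =
      e , uncovered-insert e (incident-other e a) (coveredOnceBy-delete-self (d-covers (inj₂ refl) z≢b z≢a))
    ... | no z≢a   | no z≢z₀ with ε , cov ← covered₁ z z≢b z≢a z≢a′ z≢z₀ =
      ε , coveredOnceBy-insert e (not-an-end e e∋a z≢a z≢z₀) cov
    untouched   extended z cz≡cy ¬r =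
      ∈-insert N₁ e ([]≔-minimal N _ d (edgeAt-≢ z≢a′ (same-colour⇒≢mate (trans cz≡cy (sym ca′≡cy))))
                                      (untouched S z cz≡cy (¬r ∘ reach-weaken)))
      where
      z≢a′ : z ≢ a′
      z≢a′ refl = ¬r (hop-by e≢f e∋a r)

  -- If hop e a is already reached within k hops, switch along that shorter path instead; otherwise
  -- it is a new vertex and the path to a can be extended by e.
  switch : ∀ k {a} → Reach k a → ¬ ¬ Σ (Subset m) (Switched k a)
  switch k       start              done = done (_ , switched-start k)
  switch (suc k) (hop-by e≢f e∋a r) done = ¬¬-excluded-middle λ where
    (yes r′) → switch k r′ λ (N , S) → done (N , switched-weaken S)
    (no ¬r′) → switch k r  λ (N , S) → done (_ , Extend.extended e≢f e∋a r ¬r′ S)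

  completed : ∀ {k N} → Switched k x N → MatchingThroughAvoiding H g f
  completed {N = N} S = N [ g ]≔ true , perfect , []≔-updates N g , ∉-insert N (f∉N S) (g≢f ∘ sym)
    where
    g∋x : Incident H g x
    g∋x = proj₁ (joins⇒other g-xb)
    g∋b : Incident H g b
    g∋b = proj₁ (joins⇒other (joins-sym g-xb))
    perfect : IsPerfectMatching H (N [ g ]≔ true)
    perfect z with z ≟ x | z ≟ b
    ... | yes refl | _        = g , uncovered-insert g g∋x (a-uncovered S)
    ... | no _     | yes refl = g , uncovered-insert g g∋b (b-uncovered S)
    ... | no z≢x   | no z≢b with ε , cov ← covered S z z≢b z≢x =
      ε , coveredOnceBy-insert g (λ g∋z → [ z≢x , z≢b ] (joins-ends g-xb g∋z)) cov

  forced⇒unreachable : Forces H g f → ∀ {k} → ¬ Reach k x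
  forced⇒unreachable forces r = switch _ r λ (N , S) →
    let (N* , perfect , g∈N* , f∉N*) = completed S in f∉N* (forces N* perfect g∈N*)

module _ {n m : ℕ} (H : Graph n m) where
  open Ends H

  record Square (u : Fin n) (f₁ f₂ : Fin m) : Set where
    field
      opposite  : Fin n
      h₁ h₂     : Fin m
      opposite≢ : opposite ≢ u
      h₁-joins  : Joins H h₁ opposite (other f₁ u)
      h₂-joins  : Joins H h₂ opposite (other f₂ u)

square-sym : ∀ {n m} {H : Graph n m} {u f₁ f₂} → Square H u f₁ f₂ → Square H u f₂ f₁
square-sym S = record
  { opposite = opposite ; h₁ = h₂ ; h₂ = h₁ ; opposite≢ = opposite≢ ; h₁-joins = h₂-joins ; h₂-joins = h₁-joins }
  where open Square S

module Barriers {n m : ℕ} (H : Graph n m)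
  (c : Fin n → Bool) (proper : ∀ e → c (proj₁ (ends H e)) ≢ c (proj₂ (ends H e)))
  (walk : ∀ x y → Walk H x y) (covered : ∀ e → Σ (Subset m) λ N → IsPerfectMatching H N × e ∈ N)
  {M : Subset m} (pm : IsPerfectMatching H M) where
  open Ends H
  open Colouring c proper
  open PerfectMatching H pm
  open BipartiteMatching H c proper pm
  open MatchingCovered H walk covered pm

  record Barrier (u : Fin n) (f : Fin m) : Set₁ where
    field
      Region  : Fin n → Set
      closed  : HopClosedAvoiding f Region
      colour  : ∀ a → Region a → c a ≡ c u
      ∋u      : Region u
      ∌hop    : ¬ Region (hop f u)

  closedAvoiding⇒closed : ∀ {u f R} → Incident H f u → HopClosedAvoiding f R →
    (∀ a → R a → c a ≡ c u) → (R u → R (hop f u)) → HopClosed R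
  closedAvoiding⇒closed {f = f} f∋u closed colour at-u e a e∋a Ra with e ≟ f
  ... | no e≢f   = closed e a e≢f e∋a Ra
  ... | yes refl with refl ← same-colour-end e f∋u e∋a (colour a Ra) = at-u Ra

  forced⇒barrier : ∀ {u f g} → Incident H f u → f ∉ M → g ≢ f → Forces H g f → ¬ ¬ Barrier u f
  forced⇒barrier {u} {f} {g} f∋u f∉M g≢f forces done
    with x , b , g-xb , cx≡cu ← end-of-colour g (c u) = ¬¬-excluded-middle λ where
      (no ¬Ru) → no-escape (⊥-elim ∘ ¬Ru)
      (yes Ru) → ¬¬-excluded-middle λ where
        (yes Rhop) → no-escape λ _ → Rhop
        (no ¬Rhop) → done record { Region = R ; closed = closed ; colour = colour ; ∋u = Ru ; ∌hop = ¬Rhop }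
    where
    open Switching H c proper pm f∉M g≢f g-xb
    R : Fin n → Set
    R a = ∃ λ k → Reach k a
    closed : HopClosedAvoiding f R
    closed e a e≢f e∋a (k , r) = suc k , hop-by e≢f e∋a r
    colour : ∀ a → R a → c a ≡ c u
    colour a (k , r) = trans (reach-colour r) (trans y-colour cx≡cu)
    no-escape : (R u → R (hop f u)) → ⊥
    no-escape at-u with hopClosed-meets (closedAvoiding⇒closed f∋u closed colour at-u) {y} (0 , start) x
    ... | inj₁ (k , r) = forced⇒unreachable forces r
    ... | inj₂ Rmx     = mate-colour x (trans (colour _ Rmx) (sym cx≡cu))

  module _ {u f₁ f₂} (f₁≢f₂ : f₁ ≢ f₂) (f₁∋u : Incident H f₁ u) (B₁ : Barrier u f₁) (B₂ : Barrier u f₂) where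
    open Barrier

    hop-into-union : ∀ e a → Incident H e a → Region B₁ a → Region B₁ (hop e a) ⊎ Region B₂ (hop e a)
    hop-into-union e a e∋a R₁a with e ≟ f₁
    ... | no e≢f₁  = inj₁ (closed B₁ e a e≢f₁ e∋a R₁a)
    ... | yes refl with refl ← same-colour-end e f₁∋u e∋a (colour B₁ a R₁a) =
      inj₂ (closed B₂ e a f₁≢f₂ f₁∋u (∋u B₂))

    opposite-outside : ∀ {w h} → w ≢ u → c w ≡ c u → Joins H h w (other f₁ u) → ¬ Region B₁ w
    opposite-outside {w} {h} w≢u cw≡cu h-joins R₁w with h∋w , hw≡ ← joins⇒other h-joins =
      ∌hop B₁ (subst (Region B₁ ∘ mate) hw≡ (closed B₁ h w h≢f₁ h∋w R₁w))
      where
      h≢f₁ : h ≢ f₁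
      h≢f₁ refl = w≢u (same-colour-end _ f₁∋u h∋w cw≡cu)

  barriers-incompatible : ∀ {u f₁ f₂} → f₁ ≢ f₂ → Incident H f₁ u → Incident H f₂ u → Square H u f₁ f₂ →
    Barrier u f₁ → Barrier u f₂ → ⊥
  barriers-incompatible {u} {f₁} {f₂} f₁≢f₂ f₁∋u f₂∋u sq B₁ B₂ =
    outside (hopClosed-meets union-closed (inj₁ (∋u B₁)) opposite)
    where
    open Square sq
    open Barrier
    R : Fin n → Set
    R a = Region B₁ a ⊎ Region B₂ a
    union-closed : HopClosed R
    union-closed e a e∋a (inj₁ R₁a) = hop-into-union f₁≢f₂ f₁∋u B₁ B₂ e a e∋a R₁a
    union-closed e a e∋a (inj₂ R₂a) = swap (hop-into-union (f₁≢f₂ ∘ sym) f₂∋u B₂ B₁ e a e∋a R₂a)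
    cw≡cu : c opposite ≡ c u
    cw≡cu with h₁∋w , h₁w≡ ← joins⇒other h₁-joins =
      ≢-≢⇒≡ (subst (λ v → c opposite ≢ c v) h₁w≡ (other-colour h₁ h₁∋w ∘ sym)) (other-colour f₁ f₁∋u)
    outside : ¬ (R opposite ⊎ R (mate opposite))
    outside (inj₁ (inj₁ R₁w))  = opposite-outside f₁≢f₂ f₁∋u B₁ B₂ opposite≢ cw≡cu h₁-joins R₁w
    outside (inj₁ (inj₂ R₂w))  = opposite-outside (f₁≢f₂ ∘ sym) f₂∋u B₂ B₁ opposite≢ cw≡cu h₂-joins R₂w
    outside (inj₂ (inj₁ R₁mw)) = mate-colour opposite (trans (colour B₁ _ R₁mw) (sym cw≡cu))
    outside (inj₂ (inj₂ R₂mw)) = mate-colour opposite (trans (colour B₂ _ R₂mw) (sym cw≡cu))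

module Avoidance {n m : ℕ} (H : Graph n m) where

  isPerfectMatching? : ∀ N → Dec (IsPerfectMatching H N)
  isPerfectMatching? N = all? λ v → any? λ e → (e ∈? N) ×-dec (incident? H v e ×-dec
    all? λ e′ → (e′ ∈? N) →-dec (incident? H v e′ →-dec (e′ ≟ e)))

  matchingThroughAvoiding? : ∀ g f → Dec (MatchingThroughAvoiding H g f)
  matchingThroughAvoiding? g f = anySubset? λ N → isPerfectMatching? N ×-dec ((g ∈? N) ×-dec ¬? (f ∈? N))

  avoidable? : ∀ f → Dec (Avoidable H f)
  avoidable? f = all? λ g → ¬? (g ≟ f) →-dec matchingThroughAvoiding? g f

  ¬avoidable⇒forced : ∀ {f} → ¬ Avoidable H f → Σ (Fin m) λ g → g ≢ f × Forces H g f
  ¬avoidable⇒forced {f} ¬avoidable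
    with g , ¬avoids ← ¬∀⟶∃¬ m _ (λ g → ¬? (g ≟ f) →-dec matchingThroughAvoiding? g f) ¬avoidable
    = g , g≢f , forces
    where
    g≢f : g ≢ f
    g≢f refl = ¬avoids λ g≢g → ⊥-elim (g≢g refl)
    forces : Forces H g f
    forces N pm g∈N with f ∈? N
    ... | yes f∈N = f∈N
    ... | no  f∉N = ⊥-elim (¬avoids λ _ → N , pm , g∈N , f∉N)

_++ʷ_ : ∀ {n m} {H : Graph n m} {x y z} → Walk H x y → Walk H y z → Walk H x z
here          ++ʷ w′ = w′
step e e-xy w ++ʷ w′ = step e e-xy (w ++ʷ w′)

walk-reverse : ∀ {n m} {H : Graph n m} {x y} → Walk H x y → Walk H y x
walk-reverse             here          = here
walk-reverse {H = H} (step e e-xy w) = walk-reverse w ++ʷ step e (Ends.joins-sym H e-xy) here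

module Deletion {n k : ℕ} (H : Graph n (suc k)) (f : Fin (suc k)) where
  open Ends H

  step-avoiding : ∀ {e x y z} → e ≢ f → Joins H e x y → Walk (H -ₑ f) y z → Walk (H -ₑ f) x z
  step-avoiding {e} {x} {y} e≢f e-xy =
    step (punchOut (e≢f ∘ sym)) (subst (λ e′ → Joins H e′ x y) (sym (punchIn-punchOut (e≢f ∘ sym))) e-xy)

  lift-walk : (∀ {x y} → Joins H f x y → Walk (H -ₑ f) x y) → ∀ {x y} → Walk H x y → Walk (H -ₑ f) x y
  lift-walk bypass here = here
  lift-walk bypass (step e e-xy w) with e ≟ f
  ... | yes refl = bypass e-xy ++ʷ lift-walk bypass w
  ... | no  e≢f  = step-avoiding e≢f e-xy (lift-walk bypass w)

  restrict : Subset (suc k) → Subset k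
  restrict N = tabulate (λ i → lookup N (punchIn f i))

  restrict-∈ : ∀ {N i} → punchIn f i ∈ N → i ∈ restrict N
  restrict-∈ {N} {i} p∈N = lookup⇒[]= i (restrict N) (trans (lookup∘tabulate _ i) ([]=⇒lookup p∈N))

  restrict-∈⁻ : ∀ {N i} → i ∈ restrict N → punchIn f i ∈ N
  restrict-∈⁻ {N} {i} i∈ = lookup⇒[]= (punchIn f i) N (trans (sym (lookup∘tabulate _ i)) ([]=⇒lookup i∈))

  restrict-perfect : ∀ {N} → IsPerfectMatching H N → f ∉ N → IsPerfectMatching (H -ₑ f) (restrict N)
  restrict-perfect {N} pm f∉N z =
    i , restrict-∈ (subst (_∈ N) (sym pi≡) (edgeAt∈ z)) ,
    subst (λ e → Incident H e z) (sym pi≡) (edgeAt-incident z) ,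
    λ i′ i′∈ i′∋z → punchIn-injective f i′ i (trans (edgeAt-unique z _ (restrict-∈⁻ i′∈) i′∋z) (sym pi≡))
    where
    open PerfectMatching H pm
    edgeAt∈ : ∀ z → edgeAt z ∈ N
    edgeAt∈ z = proj₁ (edgeAt-covers z)
    f≢edgeAt : f ≢ edgeAt z
    f≢edgeAt f≡ = f∉N (subst (_∈ N) (sym f≡) (edgeAt∈ z))
    i : Fin k
    i = punchOut f≢edgeAt
    pi≡ : punchIn f i ≡ edgeAt z
    pi≡ = punchIn-punchOut f≢edgeAt

  avoidable⇒removable : Connected H → (∀ {x y} → Joins H f x y → Walk (H -ₑ f) x y) →
    Avoidable H f → Removable H f
  avoidable⇒removable (2≤n , walk) bypass avoid =
    (2≤n , λ x y → lift-walk bypass (walk x y)) ,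
    λ i → let (N , pm , p∈N , f∉N) = avoid (punchIn f i) (punchInᵢ≢i f i) in
          restrict N , restrict-perfect pm f∉N , restrict-∈ p∈N

  square-walk : ∀ {u f₂} → f ≢ f₂ → Incident H f u → Incident H f₂ u → Square H u f f₂ →
    Walk (H -ₑ f) u (other f u)
  square-walk {u} {f₂} f≢f₂ f∋u f₂∋u sq =
    step-avoiding (f≢f₂ ∘ sym) (other⇒joins f₂ f₂∋u refl) (
    step-avoiding (avoids-u h₂-joins opposite≢ (other-≢ f₂ f₂∋u)) (joins-sym h₂-joins) (
    step-avoiding (avoids-u h₁-joins opposite≢ (other-≢ f f∋u)) h₁-joins here))
    where
    open Square sq
    avoids-u : ∀ {h w v} → Joins H h w v → w ≢ u → v ≢ u → h ≢ f
    avoids-u h-wv w≢u v≢u refl = [ w≢u ∘ sym , v≢u ∘ sym ] (joins-ends h-wv f∋u)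

  square-bypass : ∀ {u f₂} → f ≢ f₂ → Incident H f u → Incident H f₂ u → Square H u f f₂ →
    ∀ {x y} → Joins H f x y → Walk (H -ₑ f) x y
  square-bypass f≢f₂ f∋u f₂∋u sq f-xy with joins-ends f-xy f∋u
  ... | inj₁ refl = subst (Walk (H -ₑ f) _) (proj₂ (joins⇒other f-xy)) (square-walk f≢f₂ f∋u f₂∋u sq)
  ... | inj₂ refl = subst (λ v → Walk (H -ₑ f) v _) (proj₂ (joins⇒other (joins-sym f-xy)))
                      (walk-reverse (square-walk f≢f₂ f∋u f₂∋u sq))

  square-avoidable⇒removable : ∀ {u f₂} → Connected H → f ≢ f₂ → Incident H f u → Incident H f₂ u →
    Square H u f f₂ → Avoidable H f → Removable H f
  square-avoidable⇒removable connected f≢f₂ f∋u f₂∋u sq =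
    avoidable⇒removable connected (square-bypass f≢f₂ f∋u f₂∋u sq)

length≤2 : ∀ {A : Set} {a b : A} (xs : List A) → Unique xs → All (λ x → x ≡ a ⊎ x ≡ b) xs → length xs ≤ 2
length≤2 []              _ _ = z≤n
length≤2 (_ ∷ [])        _ _ = s≤s z≤n
length≤2 (_ ∷ _ ∷ [])    _ _ = s≤s (s≤s z≤n)
length≤2 (_ ∷ _ ∷ _ ∷ _) ((x≢y ∷ x≢z ∷ _) ∷ (y≢z ∷ _) ∷ _) (x∈ ∷ y∈ ∷ z∈ ∷ _) =
  ⊥-elim (pigeon x∈ y∈ z∈ x≢y x≢z y≢z)
  where
  pigeon : ∀ {A : Set} {a b x y z : A} → x ≡ a ⊎ x ≡ b → y ≡ a ⊎ y ≡ b → z ≡ a ⊎ z ≡ b →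
    x ≢ y → x ≢ z → y ≢ z → ⊥
  pigeon (inj₁ refl) (inj₁ refl) _           x≢y _   _   = x≢y refl
  pigeon (inj₂ refl) (inj₂ refl) _           x≢y _   _   = x≢y refl
  pigeon (inj₁ refl) (inj₂ refl) (inj₁ refl) _   x≢z _   = x≢z refl
  pigeon (inj₁ refl) (inj₂ refl) (inj₂ refl) _   _   y≢z = y≢z refl
  pigeon (inj₂ refl) (inj₁ refl) (inj₂ refl) _   x≢z _   = x≢z refl
  pigeon (inj₂ refl) (inj₁ refl) (inj₁ refl) _   _   y≢z = y≢z refl

third-edge : ∀ {n m} (H : Graph n m) {u} → 3 ≤ degree H u → ∀ f₁ f₂ →
  Σ (Fin m) λ f₃ → Incident H f₃ u × f₃ ≢ f₁ × f₃ ≢ f₂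
third-edge {m = m} H {u} 3≤deg f₁ f₂ with any? (λ e → incident? H u e ×-dec (¬? (e ≟ f₁) ×-dec ¬? (e ≟ f₂)))
... | yes found = found
... | no ¬found = ⊥-elim (3≰2 (≤-trans 3≤deg deg≤2))
  where
  one-of-two : ∀ {e} → Incident H e u → e ≡ f₁ ⊎ e ≡ f₂
  one-of-two {e} e∋u with e ≟ f₁ | e ≟ f₂
  ... | yes e≡f₁ | _        = inj₁ e≡f₁
  ... | no  _    | yes e≡f₂ = inj₂ e≡f₂
  ... | no  e≢f₁ | no  e≢f₂ = ⊥-elim (¬found (e , e∋u , e≢f₁ , e≢f₂))
  3≰2 : ¬ 3 ≤ 2
  3≰2 (s≤s (s≤s ()))
  deg≤2 : degree H u ≤ 2
  deg≤2 = length≤2 (filter (incident? H u) (allFin m)) (filter⁺ (incident? H u) (allFin⁺ m))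
            (All.map one-of-two (all-filter (incident? H u) (allFin m)))

module FourCycles {n m : ℕ} (H : Graph n m) where
  open Ends H

  record FourCycle : Set where
    field
      v₀ v₁ v₂ v₃ : Fin n
      e₀ e₁ e₂ e₃ : Fin m
      v₀≢v₁ : v₀ ≢ v₁
      v₀≢v₂ : v₀ ≢ v₂
      v₀≢v₃ : v₀ ≢ v₃
      v₁≢v₂ : v₁ ≢ v₂
      v₁≢v₃ : v₁ ≢ v₃
      v₂≢v₃ : v₂ ≢ v₃
      j₀ : Joins H e₀ v₀ v₁
      j₁ : Joins H e₁ v₁ v₂
      j₂ : Joins H e₂ v₂ v₃
      j₃ : Joins H e₃ v₃ v₀

    On : Fin m → Set
    On f = f ≡ e₀ ⊎ f ≡ e₁ ⊎ f ≡ e₂ ⊎ f ≡ e₃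

  open FourCycle

  rotate : FourCycle → FourCycle
  rotate C = record
    { v₀ = v₁ C ; v₁ = v₂ C ; v₂ = v₃ C ; v₃ = v₀ C ; e₀ = e₁ C ; e₁ = e₂ C ; e₂ = e₃ C ; e₃ = e₀ C
    ; v₀≢v₁ = v₁≢v₂ C ; v₀≢v₂ = v₁≢v₃ C ; v₀≢v₃ = v₀≢v₁ C ∘ sym
    ; v₁≢v₂ = v₂≢v₃ C ; v₁≢v₃ = v₀≢v₂ C ∘ sym ; v₂≢v₃ = v₀≢v₃ C ∘ sym
    ; j₀ = j₁ C ; j₁ = j₂ C ; j₂ = j₃ C ; j₃ = j₀ C }

  reflect : FourCycle → FourCycle
  reflect C = record
    { v₀ = v₁ C ; v₁ = v₀ C ; v₂ = v₃ C ; v₃ = v₂ C ; e₀ = e₀ C ; e₁ = e₃ C ; e₂ = e₂ C ; e₃ = e₁ C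
    ; v₀≢v₁ = v₀≢v₁ C ∘ sym ; v₀≢v₂ = v₁≢v₃ C ; v₀≢v₃ = v₁≢v₂ C
    ; v₁≢v₂ = v₀≢v₃ C ; v₁≢v₃ = v₀≢v₂ C ; v₂≢v₃ = v₂≢v₃ C ∘ sym
    ; j₀ = joins-sym (j₀ C) ; j₁ = joins-sym (j₃ C) ; j₂ = joins-sym (j₂ C) ; j₃ = joins-sym (j₁ C) }

  on-rotate : ∀ C {f} → On C f → On (rotate C) f
  on-rotate C (inj₁ f≡e₀)                 = inj₂ (inj₂ (inj₂ f≡e₀))
  on-rotate C (inj₂ (inj₁ f≡e₁))          = inj₁ f≡e₁
  on-rotate C (inj₂ (inj₂ (inj₁ f≡e₂)))   = inj₂ (inj₁ f≡e₂)
  on-rotate C (inj₂ (inj₂ (inj₂ f≡e₃)))   = inj₂ (inj₂ (inj₁ f≡e₃))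

  corner-square : ∀ C {u} → Incident H (e₀ C) u → Incident H (e₃ C) u → Square H u (e₀ C) (e₃ C)
  corner-square C e₀∋u e₃∋u with joins-ends (j₀ C) e₀∋u | joins-ends (j₃ C) e₃∋u
  ... | inj₁ refl | _         = record
    { opposite  = v₂ C ; h₁ = e₁ C ; h₂ = e₂ C ; opposite≢ = v₀≢v₂ C ∘ sym
    ; h₁-joins  = subst (Joins H (e₁ C) (v₂ C)) (sym (proj₂ (joins⇒other (j₀ C)))) (joins-sym (j₁ C))
    ; h₂-joins  = subst (Joins H (e₂ C) (v₂ C)) (sym (proj₂ (joins⇒other (joins-sym (j₃ C))))) (j₂ C) }
  ... | inj₂ refl | inj₁ refl = ⊥-elim (v₁≢v₃ C refl)
  ... | inj₂ refl | inj₂ refl = ⊥-elim (v₀≢v₁ C refl)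

  square-at-e₀ : ∀ C {u f} → Incident H (e₀ C) u → Incident H f u → e₀ C ≢ f → On C f → Square H u (e₀ C) f
  square-at-e₀ C e₀∋u f∋u e₀≢f (inj₁ refl)                 = ⊥-elim (e₀≢f refl)
  square-at-e₀ C e₀∋u f∋u e₀≢f (inj₂ (inj₁ refl))          = corner-square (reflect C) e₀∋u f∋u
  square-at-e₀ C e₀∋u f∋u e₀≢f (inj₂ (inj₂ (inj₂ refl)))   = corner-square C e₀∋u f∋u
  square-at-e₀ C e₀∋u f∋u e₀≢f (inj₂ (inj₂ (inj₁ refl)))
    with joins-ends (j₀ C) e₀∋u | joins-ends (j₂ C) f∋u
  ... | inj₁ refl | inj₁ refl = ⊥-elim (v₀≢v₂ C refl)
  ... | inj₁ refl | inj₂ refl = ⊥-elim (v₀≢v₃ C refl)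
  ... | inj₂ refl | inj₁ refl = ⊥-elim (v₁≢v₂ C refl)
  ... | inj₂ refl | inj₂ refl = ⊥-elim (v₁≢v₃ C refl)

  square-on-cycle : ∀ C {u f₁ f₂} → Incident H f₁ u → Incident H f₂ u → f₁ ≢ f₂ → On C f₁ → On C f₂ →
    Square H u f₁ f₂
  square-on-cycle C f₁∋u f₂∋u f₁≢f₂ (inj₁ refl) on₂ = square-at-e₀ C f₁∋u f₂∋u f₁≢f₂ on₂
  square-on-cycle C f₁∋u f₂∋u f₁≢f₂ (inj₂ (inj₁ refl)) on₂ =
    square-at-e₀ (rotate C) f₁∋u f₂∋u f₁≢f₂ (on-rotate C on₂)
  square-on-cycle C f₁∋u f₂∋u f₁≢f₂ (inj₂ (inj₂ (inj₁ refl))) on₂ =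
    square-at-e₀ (rotate (rotate C)) f₁∋u f₂∋u f₁≢f₂ (on-rotate (rotate C) (on-rotate C on₂))
  square-on-cycle C f₁∋u f₂∋u f₁≢f₂ (inj₂ (inj₂ (inj₂ refl))) on₂ =
    square-at-e₀ (rotate (rotate (rotate C))) f₁∋u f₂∋u f₁≢f₂
      (on-rotate (rotate (rotate C)) (on-rotate (rotate C) (on-rotate C on₂)))

  common4Cycle⇒square : ∀ {u f₁ f₂} → Incident H f₁ u → Incident H f₂ u → f₁ ≢ f₂ →
    InCommon4Cycle H f₁ f₂ → Square H u f₁ f₂
  common4Cycle⇒square f₁∋u f₂∋u f₁≢f₂
    (v₀ , v₁ , v₂ , v₃ , e₀ , e₁ , e₂ , e₃ ,
     (d₀₁ , d₀₂ , d₀₃ , d₁₂ , d₁₃ , d₂₃) , (j₀ , j₁ , j₂ , j₃) , on₁ , on₂) =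
    square-on-cycle C f₁∋u f₂∋u f₁≢f₂ on₁ on₂
    where
    C : FourCycle
    C = record { v₀ = v₀ ; v₁ = v₁ ; v₂ = v₂ ; v₃ = v₃ ; e₀ = e₀ ; e₁ = e₁ ; e₂ = e₂ ; e₃ = e₃
               ; v₀≢v₁ = d₀₁ ; v₀≢v₂ = d₀₂ ; v₀≢v₃ = d₀₃ ; v₁≢v₂ = d₁₂ ; v₁≢v₃ = d₁₃ ; v₂≢v₃ = d₂₃
               ; j₀ = j₀ ; j₁ = j₁ ; j₂ = j₂ ; j₃ = j₃ }

not-both-unavoidable : ∀ {n m} (H : Graph n m) → Bipartite H → MatchingCovered H →
  ∀ {u} → 3 ≤ degree H u → ∀ {f₁ f₂} → f₁ ≢ f₂ → Incident H f₁ u → Incident H f₂ u → Square H u f₁ f₂ →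
  ¬ Avoidable H f₁ → ¬ Avoidable H f₂ → ⊥
not-both-unavoidable H (c , proper) ((_ , walk) , covered) {u} 3≤deg {f₁} {f₂} f₁≢f₂ f₁∋u f₂∋u sq
  ¬avoid₁ ¬avoid₂
  with f₃ , f₃∋u , f₃≢f₁ , f₃≢f₂ ← third-edge H 3≤deg f₁ f₂
  with M , pm , f₃∈M ← covered f₃
  with g₁ , g₁≢f₁ , forces₁ ← Avoidance.¬avoidable⇒forced H ¬avoid₁
  with g₂ , g₂≢f₂ , forces₂ ← Avoidance.¬avoidable⇒forced H ¬avoid₂ =
  forced⇒barrier f₁∋u (∉M f₃≢f₁ f₁∋u) g₁≢f₁ forces₁ λ B₁ →
  forced⇒barrier f₂∋u (∉M f₃≢f₂ f₂∋u) g₂≢f₂ forces₂ λ B₂ →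
  barriers-incompatible f₁≢f₂ f₁∋u f₂∋u sq B₁ B₂
  where
  open Barriers H c proper walk covered pm
  open PerfectMatching H pm using (edgeAt-unique)
  ∉M : ∀ {f} → f₃ ≢ f → Incident H f u → f ∉ M
  ∉M f₃≢f f∋u f∈M = f₃≢f (trans (edgeAt-unique u f₃ f₃∈M f₃∋u) (sym (edgeAt-unique u _ f∈M f∋u)))

lemma2p6 : ∀ {n m} (H : Graph n m) → Bipartite H → MatchingCovered H →
    (u : Fin n) → 3 ≤ degree H u →
    (f₁ f₂ : Fin m) → f₁ ≢ f₂ → Incident H f₁ u → Incident H f₂ u →
    InCommon4Cycle H f₁ f₂ →
    Removable H f₁ ⊎ Removable H f₂
lemma2p6 {m = zero} _ _ _ _ _ ()
lemma2p6 {m = suc _} H bipartite mc@(connected , _) u 3≤deg f₁ f₂ f₁≢f₂ f₁∋u f₂∋u cycle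
  with sq ← FourCycles.common4Cycle⇒square H f₁∋u f₂∋u f₁≢f₂ cycle
  with Avoidance.avoidable? H f₁ | Avoidance.avoidable? H f₂
... | yes avoid₁ | _          =
  inj₁ (Deletion.square-avoidable⇒removable H f₁ connected f₁≢f₂ f₁∋u f₂∋u sq avoid₁)
... | no _       | yes avoid₂ =
  inj₂ (Deletion.square-avoidable⇒removable H f₂ connected (f₁≢f₂ ∘ sym) f₂∋u f₁∋u (square-sym sq) avoid₂)
... | no ¬avoid₁ | no ¬avoid₂ =
  ⊥-elim (not-both-unavoidable H bipartite mc 3≤deg f₁≢f₂ f₁∋u f₂∋u sq ¬avoid₁ ¬avoid₂)
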